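{- Let $\mathcal M$ be a transversal matroid of rank $r$ on $[n]$ with a presentation with exactly $r$ members, and let $I_1,\dots,I_m$ be the subsets $I\subseteq[r]$ with $l_I>0$. A sequence $a=(a_1,\dots,a_m)$ of nonnegative integers is a maximal valid type sequence of $\mathcal M$ if and only if it is a $\overline{G_{\mathcal M}}$-draconian sequence.
   Context: $\mathcal M$ has presentation $(A_1,\dots,A_r)$: bases are the transversals $\{x_1,\dots,x_r\}$, $x_j\in A_j$ distinct. The type of $x$ is $\{j\in[r]:x\in A_j\}$ and $l_I$ is the number of elements of type $I$. The sequence $a$ is valid if the multiset $\mathcal I^a$, containing $I_k$ with multiplicity $a_k$, satisfies Hall's condition (any $t$ of its members, counted with multiplicity, have union of size $\ge t$), and maximal if $\sum_k a_k=r$. $\overline{G_{\mathcal M}}\subseteq K_{m,r+1}$ is the bipartite graph with left vertices $1,\dots,m$, right vertices $0',1',\dots,r'$, and $k$ adjacent to $j'$ iff $j\in\{0\}\cup I_k$. For such a graph with associated sets $H_k=\{0\}\cup I_k$, a sequence $(a_1,\dots,a_m)$ of nonnegative integers is $\overline{G_{\mathcal M}}$-draconian if $\sum a_k=r$ and for every nonempty $\{i_1<\dots<i_k\}\subseteq[m]$, $|H_{i_1}\cup\dots\cup H_{i_k}|\geq a_{i_1}+\dots+a_{i_k}+1$. -}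

module Defs where

open import Data.Nat using (ℕ; zero; suc; _+_; _≤_; _≡ᵇ_)
open import Data.Bool using (Bool; true; false; if_then_else_; not)
open import Data.Fin using (Fin)
open import Data.Fin.Subset using (Subset; ⋃; ∣_∣; _∈_; Nonempty; inside)
open import Data.Vec using (Vec; lookup; tabulate; _∷_)
open import Data.List as List using (List)
open import Data.Nat.ListAction using (sum)
open import Data.Product using (Σ; ∃; _×_; _,_)
open import Relation.Binary.PropositionalEquality using (_≡_)
open import Function.Definitions using (Injective)

Σ[_] : (m : ℕ) → (Fin m → ℕ) → ℕ
Σ[ m ] f = sum (List.tabulate {n = m} f)

sumOver : {m : ℕ} → Subset m → (Fin m → ℕ) → ℕ
sumOver {m} S a = Σ[ m ] (λ k → if lookup S k then a k else 0)

unionOver : {m n : ℕ} → Subset m → (Fin m → Subset n) → Subset n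
unionOver {m} S F = ⋃ (List.map F (List.filter (λ k → Data.Bool._≟_ (lookup S k) true) (List.allFin m)))
  where import Data.Bool

Presentation : ℕ → ℕ → Set
Presentation n r = Fin r → Subset n

-- the presentation has a transversal {x_1,…,x_r}, x_j ∈ A_j distinct (rank r)
HasFullTransversal : {n r : ℕ} → Presentation n r → Set
HasFullTransversal {n} {r} A =
  Σ (Fin r → Fin n) λ x → Injective _≡_ _≡_ x × (∀ j → x j ∈ A j)

typeOf : {n r : ℕ} → Presentation n r → Fin n → Subset r
typeOf A x = tabulate (λ j → lookup (A j) x)

-- I_1,…,I_m is an enumeration (without repetition) of the types I with l_I > 0
IsTypeEnumeration : {n r m : ℕ} → Presentation n r → (Fin m → Subset r) → Set
IsTypeEnumeration {n} {r} {m} A I =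
  Injective _≡_ _≡_ I
  × (∀ k → ∃ λ (x : Fin n) → typeOf A x ≡ I k)
  × (∀ (x : Fin n) → ∃ λ k → typeOf A x ≡ I k)

support : {m : ℕ} → (Fin m → ℕ) → Subset m
support b = tabulate (λ k → not (b k ≡ᵇ 0))

-- Hall's condition for the multiset 𝓘^a (I_k with multiplicity a_k):
-- every sub-multiset (multiplicities b ≤ a) of total size t has union of size ≥ t
Valid : {r m : ℕ} → (Fin m → Subset r) → (Fin m → ℕ) → Set
Valid {r} {m} I a =
  (b : Fin m → ℕ) → (∀ k → b k ≤ a k) → Σ[ m ] b ≤ ∣ unionOver (support b) I ∣

MaximalValid : {r m : ℕ} → (Fin m → Subset r) → (Fin m → ℕ) → Set
MaximalValid {r} {m} I a = Valid I a × Σ[ m ] a ≡ r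

-- H_k = {0} ∪ I_k ⊆ {0,1,…,r}  (0 ↦ Fin.zero, j ↦ Fin.suc j)
H : {r m : ℕ} → (Fin m → Subset r) → Fin m → Subset (suc r)
H I k = inside ∷ I k

-- the neighbourhoods of left vertices in the bipartite graph Ḡ_M are the H_k
Draconian : {r m : ℕ} → (Fin m → Subset (suc r)) → (Fin m → ℕ) → Set
Draconian {r} {m} Hs a =
  Σ[ m ] a ≡ r
  × ((S : Subset m) → Nonempty S → sumOver S a + 1 ≤ ∣ unionOver S Hs ∣)

-- Both notions ask Σ a = r; the content is comparing Hall's condition for the
-- multiset 𝓘^a with the draconian inequalities.  The key observation is that
-- every H_k = {0} ∪ I_k contains the extra vertex 0, so for a nonempty index
-- set S the union of the H_k (k ∈ S) has exactly one more element than the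
-- union of the I_k:  |⋃_S H_k| = 1 + |⋃_S I_k|.  The draconian inequality for
-- S therefore reads  Σ_S a ≤ |⋃_S I_k|, which is Hall's condition for the
-- sub-multiset "all copies of the I_k with k ∈ S".  Conversely, a general
-- sub-multiset b ≤ a of 𝓘^a only uses the types in its support S, and
-- Σ b ≤ Σ_S a, so the inequality for S bounds it (the empty sub-multiset is
-- trivial).
module Submission where

open import Defs
open import Data.Nat using (ℕ; zero; suc; _+_; _≤_; _≡ᵇ_; z≤n; s≤s)
open import Data.Nat.Properties using (≤-refl; ≤-trans; ≤-pred; +-mono-≤; +-comm)
open import Data.Bool using (true; false; if_then_else_; not)
import Data.Bool as Bool
open import Data.Fin using (Fin)
import Data.Fin as Fin
open import Data.Fin.Subset using (Subset; ⋃; ∣_∣; _⊆_; Nonempty; Empty; inside)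
open import Data.Fin.Subset.Properties using (p⊆q⇒∣p∣≤∣q∣; x∈p∪q⁻; x∈p∪q⁺; ∉⊥; nonempty?)
open import Data.Vec using (lookup; _∷_)
open import Data.Vec.Properties using ([]=⇒lookup; lookup⇒[]=; lookup∘tabulate)
open import Data.List as List using (List; []; _∷_)
import Data.List.Membership.Propositional as List
open import Data.List.Membership.Propositional.Properties using (∈-filter⁺; ∈-filter⁻; ∈-map⁺; ∈-map⁻; ∈-allFin)
open import Data.List.Relation.Unary.Any using (here; there)
open import Data.Product using (∃; ∃₂; _,_; proj₂)
open import Data.Sum using (inj₁; inj₂)
open import Relation.Binary.PropositionalEquality using (_≡_; refl; sym; trans; subst; subst₂)
open import Data.Empty using (⊥-elim)
open import Relation.Nullary using (yes; no)
open import Function.Bundles using (_⇔_; mk⇔)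

Σ-mono : (m : ℕ) (f g : Fin m → ℕ) → (∀ k → f k ≤ g k) → Σ[ m ] f ≤ Σ[ m ] g
Σ-mono zero    f g f≤g = z≤n
Σ-mono (suc m) f g f≤g =
  +-mono-≤ (f≤g Fin.zero) (Σ-mono m (λ k → f (Fin.suc k)) (λ k → g (Fin.suc k)) (λ k → f≤g (Fin.suc k)))

Σ-zero : (m : ℕ) (f : Fin m → ℕ) → (∀ k → f k ≡ 0) → Σ[ m ] f ≡ 0
Σ-zero zero    f f≡0 = refl
Σ-zero (suc m) f f≡0 rewrite f≡0 Fin.zero = Σ-zero m (λ k → f (Fin.suc k)) (λ k → f≡0 (Fin.suc k))

restrict : {m : ℕ} → Subset m → (Fin m → ℕ) → Fin m → ℕ
restrict S a k = if lookup S k then a k else 0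

restrict-≤ : {m : ℕ} (S : Subset m) (a : Fin m → ℕ) (k : Fin m) → restrict S a k ≤ a k
restrict-≤ S a k with lookup S k
... | true  = ≤-refl
... | false = z≤n

lookup-support : {m : ℕ} (b : Fin m → ℕ) (k : Fin m) → lookup (support b) k ≡ not (b k ≡ᵇ 0)
lookup-support b k = lookup∘tabulate (λ j → not (b j ≡ᵇ 0)) k

support-restrict : {m : ℕ} (S : Subset m) (a : Fin m → ℕ) (k : Fin m) →
                   lookup (support (restrict S a)) k ≡ true → lookup S k ≡ true
support-restrict S a k k∈supp with lookup S k | trans (sym (lookup-support (restrict S a) k)) k∈supp
... | true  | _  = refl
... | false | ()

≤-restrict-support : {m : ℕ} (a b : Fin m → ℕ) (k : Fin m) →
                     b k ≤ a k → b k ≤ restrict (support b) a k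
≤-restrict-support a b k b≤a rewrite lookup-support b k with b k
... | zero  = z≤n
... | suc _ = b≤a

empty-support⇒zero : {m : ℕ} (b : Fin m → ℕ) → Empty (support b) → ∀ k → b k ≡ 0
empty-support⇒zero b empty k with b k in bk≡
... | zero  = refl
... | suc _ = ⊥-elim (empty (k , lookup⇒[]= k (support b) k∈supp))
  where
  k∈supp : lookup (support b) k ≡ true
  k∈supp rewrite lookup-support b k | bk≡ = refl

selected : {m : ℕ} → Subset m → List (Fin m)
selected {m} S = List.filter (λ k → lookup S k Bool.≟ true) (List.allFin m)

selected⁺ : {m : ℕ} (S : Subset m) (k : Fin m) → lookup S k ≡ true → k List.∈ selected S
selected⁺ {m} S k k∈S = ∈-filter⁺ (λ j → lookup S j Bool.≟ true) {xs = List.allFin m} (∈-allFin k) k∈S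

selected⁻ : {m : ℕ} (S : Subset m) (k : Fin m) → k List.∈ selected S → lookup S k ≡ true
selected⁻ {m} S k k∈sel = proj₂ (∈-filter⁻ (λ j → lookup S j Bool.≟ true) {xs = List.allFin m} k∈sel)

selected-nonempty : {m : ℕ} (S : Subset m) → Nonempty S → ∃₂ λ k L → selected S ≡ k ∷ L
selected-nonempty S (k , k∈S) with selected S | selected⁺ S k ([]=⇒lookup k∈S)
... | j ∷ L | _ = j , L , refl

⊆-⋃ : {r : ℕ} {p : Subset r} (ps : List (Subset r)) → p List.∈ ps → p ⊆ ⋃ ps
⊆-⋃ (q ∷ ps) (here refl) x∈p = x∈p∪q⁺ (inj₁ x∈p)
⊆-⋃ (q ∷ ps) (there p∈) x∈p = x∈p∪q⁺ (inj₂ (⊆-⋃ ps p∈ x∈p))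

⋃-least : {r : ℕ} {q : Subset r} (ps : List (Subset r)) → (∀ {p} → p List.∈ ps → p ⊆ q) → ⋃ ps ⊆ q
⋃-least []       bound x∈⋃ = ⊥-elim (∉⊥ x∈⋃)
⋃-least (p ∷ ps) bound {x} x∈⋃ with x∈p∪q⁻ p (⋃ ps) x∈⋃
... | inj₁ x∈p  = bound (here refl) x∈p
... | inj₂ x∈ps = ⋃-least ps (λ p∈ → bound (there p∈)) x∈ps

unionOver-mono : {m r : ℕ} (S T : Subset m) (F : Fin m → Subset r) →
                 (∀ k → lookup S k ≡ true → lookup T k ≡ true) → unionOver S F ⊆ unionOver T F
unionOver-mono S T F S⊆T = ⋃-least (List.map F (selected S)) member⊆
  where
  member⊆ : ∀ {p} → p List.∈ List.map F (selected S) → p ⊆ unionOver T F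
  member⊆ p∈ with ∈-map⁻ F p∈
  ... | k , k∈S , refl =
    ⊆-⋃ (List.map F (selected T)) (∈-map⁺ F (selected⁺ T k (S⊆T k (selected⁻ S k k∈S))))

⋃-adjoin : {A : Set} {r : ℕ} (F : A → Subset r) (L : List A) →
           ∃ λ s → ⋃ (List.map (λ k → inside ∷ F k) L) ≡ s ∷ ⋃ (List.map F L)
⋃-adjoin F []      = _ , refl
⋃-adjoin F (k ∷ L) with ⋃-adjoin F L
... | s , eq rewrite eq = inside , refl

∣⋃-adjoin∣ : {A : Set} {r : ℕ} (F : A → Subset r) (k : A) (L : List A) →
             ∣ ⋃ (List.map (λ j → inside ∷ F j) (k ∷ L)) ∣ ≡ suc ∣ ⋃ (List.map F (k ∷ L)) ∣
∣⋃-adjoin∣ F k L with ⋃-adjoin F L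
... | s , eq rewrite eq = refl

∣unionOver-H∣ : {r m : ℕ} (I : Fin m → Subset r) (S : Subset m) → Nonempty S →
                ∣ unionOver S (H I) ∣ ≡ suc ∣ unionOver S I ∣
∣unionOver-H∣ I S S≠∅ with selected S | selected-nonempty S S≠∅
... | _ | k , L , refl = ∣⋃-adjoin∣ I k L

valid⇒draconian-bound : {r m : ℕ} (I : Fin m → Subset r) (a : Fin m → ℕ) → Valid I a →
                        (S : Subset m) → Nonempty S → sumOver S a + 1 ≤ ∣ unionOver S (H I) ∣
valid⇒draconian-bound I a valid S S≠∅ =
  subst₂ _≤_ (sym (+-comm (sumOver S a) 1)) (sym (∣unionOver-H∣ I S S≠∅)) (s≤s hall-S)
  where
  hall-S : sumOver S a ≤ ∣ unionOver S I ∣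
  hall-S = ≤-trans (valid (restrict S a) (restrict-≤ S a))
                   (p⊆q⇒∣p∣≤∣q∣ (unionOver-mono (support (restrict S a)) S I (support-restrict S a)))

draconian-bound⇒valid : {r m : ℕ} (I : Fin m → Subset r) (a : Fin m → ℕ) →
                        ((S : Subset m) → Nonempty S → sumOver S a + 1 ≤ ∣ unionOver S (H I) ∣) →
                        Valid I a
draconian-bound⇒valid {m = m} I a bound b b≤a with nonempty? (support b)
... | no  empty = subst (_≤ ∣ unionOver (support b) I ∣) (sym (Σ-zero m b (empty-support⇒zero b empty))) z≤n
... | yes S≠∅   = ≤-trans Σb≤ΣSa (≤-pred draconian-S)
  where
  S : Subset m
  S = support b
  Σb≤ΣSa : Σ[ m ] b ≤ sumOver S a
  Σb≤ΣSa = Σ-mono m b (restrict S a) (λ k → ≤-restrict-support a b k (b≤a k))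
  draconian-S : suc (sumOver S a) ≤ suc ∣ unionOver S I ∣
  draconian-S = subst₂ _≤_ (+-comm (sumOver S a) 1) (∣unionOver-H∣ I S S≠∅) (bound S S≠∅)

mainTheorem11 : (n r : ℕ) → (A : Presentation n r) → HasFullTransversal A →
                (m : ℕ) → (I : Fin m → Subset r) → IsTypeEnumeration A I →
                (a : Fin m → ℕ) →
                MaximalValid I a ⇔ Draconian (H I) a
mainTheorem11 n r A _ m I _ a = mk⇔
  (λ (valid , Σa≡r) → Σa≡r , valid⇒draconian-bound I a valid)
  (λ (Σa≡r , bound) → draconian-bound⇒valid I a bound , Σa≡r)
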